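{- Let $T$ be a tree of order $n\ge 2$, and let $d(T)$ be the depth of $T$ produced by any execution of Algorithm 1 (for any choice of balanced edges). Then $\max\{\Delta(T),\lceil \log_2 n\rceil\}\le d(T)\le n-1$.
   Context: For a tree $T$, an edge $e$ is balanced if the absolute difference of the numbers of edges of the two components of $T-e$ is minimum among all edges of $T$. Algorithm 1: start with the forest $F=T$. While $F$ has a component with more than one vertex, perform an iteration: simultaneously, from each component of $F$ with more than one vertex, delete one balanced edge (balanced with respect to that component); an edge deleted in the $i$-th iteration gets depth $i$ and is colored $i$. The depth $d(T)$ is the number of iterations performed. $\Delta(T)$ is the maximum degree. -}

module Defs where

open import Data.Nat using (ℕ; zero; suc; _+_; _≤_; _⊔_; ∣_-_∣)
open import Data.Nat.Logarithm using (⌈log₂_⌉)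
open import Data.Fin using (Fin; _≟_)
open import Data.Bool using (Bool; true; false; _∧_; not; if_then_else_)
open import Data.Product using (_×_; _,_; proj₁; proj₂; ∃; ∃-syntax; Σ)
open import Data.Sum using (_⊎_)
open import Data.List using (List; length; tabulate; foldr)
open import Data.Nat.ListAction using (sum)
open import Data.List.Membership.Propositional using (_∈_)
open import Data.List.Relation.Unary.Unique.Propositional using (Unique)
open import Relation.Binary.PropositionalEquality using (_≡_)
open import Relation.Nullary using (does)
open import Function.Bundles using (_⇔_)

-- A (multi)graph on vertex set Fin n with edges indexed by Fin m;
-- `ends i` gives the two end vertices of edge i.
-- An edge subset (a spanning subforest) is a Boolean predicate on edge indices.
EdgeSet : ℕ → Set
EdgeSet m = Fin m → Bool

module _ {n m : ℕ} (ends : Fin m → Fin n × Fin n) where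

  Joins : Fin m → Fin n → Fin n → Set
  Joins i u w = (proj₁ (ends i) ≡ u × proj₂ (ends i) ≡ w)
              ⊎ (proj₁ (ends i) ≡ w × proj₂ (ends i) ≡ u)

  data Reach (F : EdgeSet m) : Fin n → Fin n → Set where
    here : ∀ {u} → Reach F u u
    step : ∀ {u w v} (i : Fin m) → F i ≡ true → Joins i u w → Reach F w v → Reach F u v

  IsTree : Set
  IsTree = (m + 1 ≡ n) × (∀ u v → Reach (λ _ → true) u v)

  -- degree of a vertex in the full graph (a loop would count twice)
  deg : Fin n → ℕ
  deg v = sum (tabulate (λ i → (if does (proj₁ (ends i) ≟ v) then 1 else 0)
                             + (if does (proj₂ (ends i) ≟ v) then 1 else 0)))

  Δ : ℕ
  Δ = foldr _⊔_ 0 (tabulate deg)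

  HasSize : (Fin m → Set) → ℕ → Set
  HasSize P k = Σ (List (Fin m)) λ xs → Unique xs × length xs ≡ k × (∀ i → P i ⇔ (i ∈ xs))

  CompEdge : EdgeSet m → Fin n → Fin m → Set
  CompEdge F v i = F i ≡ true × Reach F v (proj₁ (ends i))

  del : EdgeSet m → Fin m → EdgeSet m
  del F e i = F i ∧ not (does (i ≟ e))

  Imbalance : EdgeSet m → Fin m → ℕ → Set
  Imbalance F e k = ∃[ x ] ∃[ y ]
      HasSize (CompEdge (del F e) (proj₁ (ends e))) x
    × HasSize (CompEdge (del F e) (proj₂ (ends e))) y
    × k ≡ ∣ x - y ∣

  Balanced : EdgeSet m → Fin m → Set
  Balanced F e = F e ≡ true × ∃[ k ] (Imbalance F e k ×
      (∀ e' → CompEdge F (proj₁ (ends e)) e' → ∀ k' → Imbalance F e' k' → k ≤ k'))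

  -- one iteration of Algorithm 1: from each component of F having an edge
  -- (i.e. more than one vertex) exactly one balanced edge is deleted
  Step : EdgeSet m → EdgeSet m → Set
  Step F F' = Σ (EdgeSet m) λ S →
      (∀ i → S i ≡ true → Balanced F i)
    × (∀ i j → S i ≡ true → S j ≡ true → Reach F (proj₁ (ends i)) (proj₁ (ends j)) → i ≡ j)
    × (∀ i → F i ≡ true → ∃[ j ] (S j ≡ true × Reach F (proj₁ (ends i)) (proj₁ (ends j))))
    × (∀ i → F' i ≡ F i ∧ not (S i))

  -- Run F d : some execution of Algorithm 1 started from forest F
  -- performs exactly d iterations before no component has more than one vertex
  data Run : EdgeSet m → ℕ → Set where
    stop : ∀ {F} → (∀ i → F i ≡ false) → Run F 0
    iter : ∀ {F F' d} → ∃[ i ] (F i ≡ true) → Step F F' → Run F' d → Run F (suc d)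

  IsDepth : ℕ → Set
  IsDepth d = Run (λ _ → true) d

-- None of the bounds uses that the deleted edges are balanced; each only uses
-- that an iteration deletes exactly one edge from every component having edges.
--
--  * Upper bound: every iteration deletes at least one edge, so the number of
--    iterations is at most the number n - 1 of edges.
--  * Degree bound: a tree has no loops (deleting a loop would leave a connected
--    graph on n vertices with n - 2 edges, while a graph with r roots has at most
--    r + |F| vertices).  Hence the edges at a vertex v lie in one component and
--    each iteration deletes at most one of them, so deg v ≤ d.
--  * Logarithmic bound: an iteration splits each component at its deleted edge e
--    into the vertices still reaching one end of e and those reaching the other,
--    so after d iterations a component of the original forest has at most 2^d
--    vertices; for the whole tree this gives n ≤ 2^d.
module Submission where

open import Defs
open import Data.Nat using (ℕ; zero; suc; _+_; _^_; _≤_; _<_; _⊔_; _∸_; z≤n; s≤s; s≤s⁻¹)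
open import Data.Nat.Properties
  using (≤-refl; ≤-reflexive; ≤-trans; +-mono-≤; +-monoʳ-≤; +-mono-<-≤; +-mono-≤-<;
         +-suc; +-comm; +-identityʳ; m≤m+n; m^n>0; m+1+n≰m; ⊔-lub; suc-injective)
open import Data.Nat.Logarithm using (⌈log₂_⌉; ⌈log₂⌉-mono-≤; ⌈log₂2^n⌉≡n)
open import Data.Fin using (Fin; zero; suc; _≟_)
open import Data.Fin.Properties using (any?; 0≢1+n) renaming (suc-injective to fsuc-injective)
open import Data.Bool using (Bool; true; false; _∧_; not; if_then_else_)
open import Data.Bool.Properties using (∧-zeroʳ; ∧-conicalˡ; ∧-conicalʳ) renaming (_≟_ to _≟ᵇ_)
open import Data.Product using (_×_; _,_; proj₁; proj₂; ∃-syntax)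
open import Data.Sum using (_⊎_; inj₁; inj₂; [_,_]′; swap) renaming (map to map⊎)
open import Data.Empty using (⊥-elim)
open import Data.List using (List; []; _∷_; length; tabulate)
open import Data.List.Properties using (length-tabulate; length-removeAt′; foldr-preservesᵇ)
open import Data.Nat.ListAction using (sum)
open import Data.List.Membership.Propositional using (_∈_; _─_)
open import Data.List.Relation.Unary.Any using (here; there; index)
open import Data.List.Relation.Unary.All using (All; []; _∷_) renaming (map to mapAll)
open import Data.List.Relation.Unary.All.Properties using (tabulate⁺)
open import Data.List.Relation.Unary.Unique.Propositional using (Unique; []; _∷_)
open import Data.List.Relation.Unary.Unique.Propositional.Properties using (allFin⁺)
open import Function using (id; _∘_)
open import Relation.Binary.PropositionalEquality
  using (_≡_; _≢_; refl; sym; trans; cong; cong₂; subst; subst₂)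
open import Relation.Nullary using (Dec; yes; no; does)
open import Relation.Nullary.Decidable using (dec-true)

does-true : ∀ {A : Set} (a? : Dec A) → does a? ≡ true → A
does-true (yes a) _ = a
does-true (no _) ()

if-mono : ∀ {b c : Bool} x → (b ≡ true → c ≡ true) → (if b then x else 0) ≤ (if c then x else 0)
if-mono {false} x _ = z≤n
if-mono {true} x b⇒c rewrite b⇒c refl = ≤-refl

ΣF : ∀ {m} → (Fin m → ℕ) → ℕ
ΣF f = sum (tabulate f)

ΣF-mono : ∀ {m} {g h : Fin m → ℕ} → (∀ i → g i ≤ h i) → ΣF g ≤ ΣF h
ΣF-mono {zero} _ = z≤n
ΣF-mono {suc m} g≤h = +-mono-≤ (g≤h zero) (ΣF-mono (g≤h ∘ suc))

ΣF-strict : ∀ {m} {g h : Fin m → ℕ} (i : Fin m) → (∀ j → g j ≤ h j) → g i < h i → ΣF g < ΣF h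
ΣF-strict {suc m} zero g≤h gᵢ<hᵢ = +-mono-<-≤ gᵢ<hᵢ (ΣF-mono (g≤h ∘ suc))
ΣF-strict {suc m} (suc i) g≤h gᵢ<hᵢ = +-mono-≤-< (g≤h zero) (ΣF-strict i (g≤h ∘ suc) gᵢ<hᵢ)

ΣF-≤-suc : ∀ {m} (g h k : Fin m → ℕ) → (∀ i → g i ≤ k i + h i) → (∀ i → k i ≤ 1) →
           (∀ i j → 0 < k i → 0 < k j → i ≡ j) → ΣF g ≤ suc (ΣF h)
ΣF-≤-suc {zero} _ _ _ _ _ _ = z≤n
ΣF-≤-suc {suc m} g h k g≤k+h k≤1 once with k zero in k₀
... | zero = ≤-trans (+-mono-≤ g₀≤h₀ rest) (≤-reflexive (+-suc (h zero) _))
  where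
    g₀≤h₀ : g zero ≤ h zero
    g₀≤h₀ = subst (λ x → g zero ≤ x + h zero) k₀ (g≤k+h zero)
    rest : ΣF (g ∘ suc) ≤ suc (ΣF (h ∘ suc))
    rest = ΣF-≤-suc (g ∘ suc) (h ∘ suc) (k ∘ suc) (g≤k+h ∘ suc) (k≤1 ∘ suc)
             (λ i j kᵢ kⱼ → fsuc-injective (once (suc i) (suc j) kᵢ kⱼ))
... | suc _ = +-mono-≤ (≤-trans (g≤k+h zero) (+-mono-≤ (k≤1 zero) ≤-refl)) (ΣF-mono rest)
  where
    rest : ∀ i → g (suc i) ≤ h (suc i)
    rest i with k (suc i) in kᵢ
    ... | zero = subst (λ x → g (suc i) ≤ x + h (suc i)) kᵢ (g≤k+h (suc i))
    ... | suc _ = ⊥-elim (0≢1+n (once zero (suc i) (subst (0 <_) (sym k₀) (s≤s z≤n))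
                                                   (subst (0 <_) (sym kᵢ) (s≤s z≤n))))

ΣF-zero : ∀ {m} {f : Fin m → ℕ} → (∀ i → f i ≡ 0) → ΣF f ≡ 0
ΣF-zero {zero} _ = refl
ΣF-zero {suc m} f≡0 = cong₂ _+_ (f≡0 zero) (ΣF-zero (f≡0 ∘ suc))

ΣF-one : ∀ m → ΣF {m} (λ _ → 1) ≡ m
ΣF-one zero = refl
ΣF-one (suc m) = cong suc (ΣF-one m)

module _ {A : Set} where

  ∈-─ : ∀ {x y : A} {R : List A} (x∈R : x ∈ R) → y ∈ R → y ≢ x → y ∈ R ─ x∈R
  ∈-─ (here refl) (here y≡x) y≢x = ⊥-elim (y≢x y≡x)
  ∈-─ (here refl) (there y∈R) _ = y∈R
  ∈-─ (there _) (here y≡z) _ = here y≡z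
  ∈-─ (there x∈R) (there y∈R) y≢x = there (∈-─ x∈R y∈R y≢x)

  unique-⊆-length : ∀ {L R : List A} → Unique L → All (_∈ R) L → length L ≤ length R
  unique-⊆-length {[]} _ _ = z≤n
  unique-⊆-length {x ∷ L} {R} (x∉L ∷ uniq) (x∈R ∷ L⊆R) =
    subst (suc (length L) ≤_) (sym (length-removeAt′ R (index x∈R)))
      (s≤s (unique-⊆-length uniq (keep x∉L L⊆R)))
    where
      keep : ∀ {K} → All (x ≢_) K → All (_∈ R) K → All (_∈ R ─ x∈R) K
      keep [] [] = []
      keep (x≢y ∷ x≢K) (y∈R ∷ K⊆R) = ∈-─ x∈R y∈R (x≢y ∘ sym) ∷ keep x≢K K⊆R

  lefts : ∀ {P Q : A → Set} {L} → All (λ x → P x ⊎ Q x) L → List A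
  lefts [] = []
  lefts {L = x ∷ _} (inj₁ _ ∷ tags) = x ∷ lefts tags
  lefts (inj₂ _ ∷ tags) = lefts tags

  lefts-left : ∀ {P Q : A → Set} {L} (tags : All (λ x → P x ⊎ Q x) L) → All P (lefts tags)
  lefts-left [] = []
  lefts-left (inj₁ p ∷ tags) = p ∷ lefts-left tags
  lefts-left (inj₂ _ ∷ tags) = lefts-left tags

  lefts-keeps : ∀ {P Q W : A → Set} {L} (tags : All (λ x → P x ⊎ Q x) L) → All W L → All W (lefts tags)
  lefts-keeps [] [] = []
  lefts-keeps (inj₁ _ ∷ tags) (w ∷ ws) = w ∷ lefts-keeps tags ws
  lefts-keeps (inj₂ _ ∷ tags) (_ ∷ ws) = lefts-keeps tags ws

  lefts-unique : ∀ {P Q : A → Set} {L} (tags : All (λ x → P x ⊎ Q x) L) → Unique L → Unique (lefts tags)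
  lefts-unique [] [] = []
  lefts-unique (inj₁ _ ∷ tags) (x∉L ∷ uniq) = lefts-keeps tags x∉L ∷ lefts-unique tags uniq
  lefts-unique (inj₂ _ ∷ tags) (_ ∷ uniq) = lefts-unique tags uniq

  length-lefts : ∀ {P Q : A → Set} {L} (tags : All (λ x → P x ⊎ Q x) L) →
                 length L ≡ length (lefts tags) + length (lefts (mapAll swap tags))
  length-lefts [] = refl
  length-lefts (inj₁ _ ∷ tags) = cong suc (length-lefts tags)
  length-lefts (inj₂ _ ∷ tags) = trans (cong suc (length-lefts tags)) (sym (+-suc _ _))

  length-split : ∀ {P Q : A → Set} {a b L} →
                 (∀ {K} → Unique K → All P K → length K ≤ a) →
                 (∀ {K} → Unique K → All Q K → length K ≤ b) →
                 Unique L → All (λ x → P x ⊎ Q x) L → length L ≤ a + b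
  length-split boundP boundQ uniq tags =
    subst (_≤ _) (sym (length-lefts tags))
      (+-mono-≤ (boundP (lefts-unique tags uniq) (lefts-left tags))
                (boundQ (lefts-unique (mapAll swap tags) uniq) (lefts-left (mapAll swap tags))))

  unique-constant : ∀ {r : A} {L} → Unique L → All (r ≡_) L → length L ≤ 1
  unique-constant {L = []} _ _ = z≤n
  unique-constant {L = _ ∷ []} _ _ = s≤s z≤n
  unique-constant {L = _ ∷ _ ∷ _} ((x≢y ∷ _) ∷ _) (r≡x ∷ r≡y ∷ _) = ⊥-elim (x≢y (trans (sym r≡x) r≡y))

module Forest {n m : ℕ} (ends : Fin m → Fin n × Fin n) where

  e₁ e₂ : Fin m → Fin n
  e₁ i = proj₁ (ends i)
  e₂ i = proj₂ (ends i)

  Walk : EdgeSet m → Fin n → Fin n → Set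
  Walk = Reach ends

  walk-trans : ∀ {F u v w} → Walk F u v → Walk F v w → Walk F u w
  walk-trans here q = q
  walk-trans (step i Fi j p) q = step i Fi j (walk-trans p q)

  walk-sym : ∀ {F u v} → Walk F u v → Walk F v u
  walk-sym here = here
  walk-sym (step i Fi j p) = walk-trans (walk-sym p) (step i Fi (swap j) here)

  walk-empty : ∀ {F u v} → (∀ i → F i ≡ false) → Walk F u v → u ≡ v
  walk-empty _ here = refl
  walk-empty none (step i Fi _ _) with trans (sym Fi) (none i)
  ... | ()

  End : Fin m → Fin n → Set
  End i v = e₁ i ≡ v ⊎ e₂ i ≡ v

  Touches : EdgeSet m → Fin n → Fin m → Set
  Touches F u e = Walk F u (e₁ e) ⊎ Walk F u (e₂ e)

  joins-end : ∀ {i u w} → Joins ends i u w → End i u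
  joins-end = map⊎ proj₁ proj₂

  end-touches : ∀ {F i v} → End i v → Touches F v i
  end-touches {F} {v = v} = map⊎ (λ e₁≡v → subst (Walk F v) (sym e₁≡v) here)
                                  (λ e₂≡v → subst (Walk F v) (sym e₂≡v) here)

  touches-end₁ : ∀ {F i u} → F i ≡ true → Touches F u i → Walk F u (e₁ i)
  touches-end₁ _ (inj₁ u⇝e₁) = u⇝e₁
  touches-end₁ {i = i} Fi (inj₂ u⇝e₂) = walk-trans u⇝e₂ (step i Fi (inj₂ (refl , refl)) here)

  first-edge : ∀ {F u v} → Walk F u v → u ≢ v → ∃[ i ] (F i ≡ true × Walk F u (e₁ i))
  first-edge here u≢u = ⊥-elim (u≢u refl)
  first-edge (step i Fi j _) _ = i , Fi , touches-end₁ Fi (end-touches (joins-end j))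

  first-crossing : ∀ {F F' S : EdgeSet m} {e u t} → (∀ i → F' i ≡ F i ∧ not (S i)) →
                   (∀ i → S i ≡ true → Walk F u (e₁ i) → i ≡ e) →
                   Walk F u t → Walk F' u t ⊎ Touches F' u e
  first-crossing _ _ here = inj₁ here
  first-crossing {F} {F'} {S} F'≡ only-e (step i Fi j p) with S i in Sᵢ
  ... | true with only-e i Sᵢ (touches-end₁ Fi (end-touches (joins-end j)))
  ...   | refl = inj₂ (end-touches (joins-end j))
  first-crossing {F} {F'} {S} F'≡ only-e (step i Fi j p) | false =
    map⊎ extend (map⊎ extend extend)
      (first-crossing F'≡ (λ i' Sᵢ' w⇝i' → only-e i' Sᵢ' (step i Fi j w⇝i')) p)
    where
      F'ᵢ : F' i ≡ true
      F'ᵢ = trans (F'≡ i) (cong₂ (λ a s → a ∧ not s) Fi Sᵢ)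
      extend : ∀ {x} → Walk F' _ x → Walk F' _ x
      extend = step i F'ᵢ j

  del-splits : ∀ {F i u t} → Walk F u t → Walk (del ends F i) u t ⊎ Touches (del ends F i) u i
  del-splits {i = i} = first-crossing (λ _ → refl) (λ j s _ → does-true (j ≟ i) s)

  -- Deleting a loop disconnects nothing: split a walk at its first and at its last
  -- use of the loop.
  loop-deletion : ∀ {F i u v} → e₁ i ≡ e₂ i → Walk F u v → Walk (del ends F i) u v
  loop-deletion {F} {i} loop u⇝v with del-splits {i = i} u⇝v | del-splits {i = i} (walk-sym u⇝v)
  ... | inj₁ q | _ = q
  ... | inj₂ _ | inj₁ q = walk-sym q
  ... | inj₂ tu | inj₂ tv = walk-trans (to-loop tu) (walk-sym (to-loop tv))
    where
      to-loop : ∀ {x} → Touches (del ends F i) x i → Walk (del ends F i) x (e₁ i)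
      to-loop = [ id , subst (Walk _ _) (sym loop) ]′

  step-splits : ∀ {F F' u} (st : Step ends F F') (e : Fin m) → proj₁ st e ≡ true →
                Walk F u (e₁ e) → Touches F' u e
  step-splits (S , _ , one-per-component , _ , F'≡) e Sₑ u⇝e =
    [ inj₁ , id ]′ (first-crossing F'≡ only-e u⇝e)
    where
      only-e : ∀ i → S i ≡ true → Walk _ _ (e₁ i) → i ≡ e
      only-e i Sᵢ u⇝i = one-per-component i e Sᵢ Sₑ (walk-trans (walk-sym u⇝i) u⇝e)

  _⊆ᴱ_ : EdgeSet m → EdgeSet m → Set
  F' ⊆ᴱ F = ∀ i → F' i ≡ true → F i ≡ true

  del-⊆ : ∀ F i → del ends F i ⊆ᴱ F
  del-⊆ F i j = ∧-conicalˡ (F j) _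

  weight : EdgeSet m → (Fin m → ℕ) → ℕ
  weight F w = ΣF (λ i → if F i then w i else 0)

  size : EdgeSet m → ℕ
  size F = weight F (λ _ → 1)

  weight-empty : ∀ {F} w → (∀ i → F i ≡ false) → weight F w ≡ 0
  weight-empty w none = ΣF-zero (λ i → cong (λ b → if b then w i else 0) (none i))

  size-shrinks : ∀ {F F'} i → F' ⊆ᴱ F → F' i ≡ false → F i ≡ true → size F' < size F
  size-shrinks {F} {F'} i F'⊆F F'ᵢ Fᵢ =
    ΣF-strict i (λ j → if-mono 1 (F'⊆F j))
      (subst₂ (λ b c → (if b then 1 else 0) < (if c then 1 else 0)) (sym F'ᵢ) (sym Fᵢ) ≤-refl)

  weight-drop≤1 : ∀ {F F' S : EdgeSet m} w → (∀ i → F' i ≡ F i ∧ not (S i)) → (∀ i → w i ≤ 1) →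
                  (∀ i j → F i ∧ S i ≡ true → F j ∧ S j ≡ true → 0 < w i → 0 < w j → i ≡ j) →
                  weight F w ≤ suc (weight F' w)
  weight-drop≤1 {F} {F'} {S} w F'≡ w≤1 once =
    ΣF-≤-suc _ _ deleted split (λ i → bounded (F i ∧ S i) (w≤1 i)) unique
    where
      deleted : Fin m → ℕ
      deleted i = if F i ∧ S i then w i else 0
      bounded : ∀ b {x} → x ≤ 1 → (if b then x else 0) ≤ 1
      bounded true x≤1 = x≤1
      bounded false _ = z≤n
      positive : ∀ b {x} → 0 < (if b then x else 0) → b ≡ true × 0 < x
      positive true 0<x = refl , 0<x
      positive false ()
      split-at : ∀ b s x → (if b then x else 0) ≤ (if b ∧ s then x else 0) + (if b ∧ not s then x else 0)
      split-at false _ _ = z≤n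
      split-at true true x = m≤m+n x 0
      split-at true false _ = ≤-refl
      split : ∀ i → (if F i then w i else 0) ≤ deleted i + (if F' i then w i else 0)
      split i rewrite F'≡ i = split-at (F i) (S i) (w i)
      unique : ∀ i j → 0 < deleted i → 0 < deleted j → i ≡ j
      unique i j dᵢ dⱼ with positive (F i ∧ S i) dᵢ | positive (F j ∧ S j) dⱼ
      ... | FSᵢ , wᵢ | FSⱼ , wⱼ = once i j FSᵢ FSⱼ wᵢ wⱼ

  step-shrinks : ∀ {F F'} → Step ends F F' → ∃[ i ] (F i ≡ true) → size F' < size F
  step-shrinks {F} {F'} (S , balanced , _ , covered , F'≡) (i , Fᵢ) with covered i Fᵢ
  ... | j , Sⱼ , _ = size-shrinks j F'⊆F F'ⱼ (proj₁ (balanced j Sⱼ))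
    where
      F'⊆F : F' ⊆ᴱ F
      F'⊆F k F'ₖ = ∧-conicalˡ (F k) _ (trans (sym (F'≡ k)) F'ₖ)
      F'ⱼ : F' j ≡ false
      F'ⱼ = trans (F'≡ j) (trans (cong (λ s → F j ∧ not s) Sⱼ) (∧-zeroʳ (F j)))

  depth≤size : ∀ {F d} → Run ends F d → d ≤ size F
  depth≤size (stop _) = z≤n
  depth≤size (iter nonempty st run) = ≤-trans (s≤s (depth≤size run)) (step-shrinks st nonempty)

  Rooted : EdgeSet m → List (Fin n) → Set
  Rooted F Rs = ∀ v → ∃[ r ] (r ∈ Rs × Walk F v r)

  -- A graph with a list of roots Rs has at most |Rs| + |F| vertices: deleting an
  -- edge i costs at most one new root, an end of i no longer joined to its old root.
  vertices≤roots+edges : ∀ F Rs → Rooted F Rs → n ≤ length Rs + size F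
  vertices≤roots+edges F = go (suc (size F)) F ≤-refl
    where
      go : ∀ k F → size F < k → ∀ Rs → Rooted F Rs → n ≤ length Rs + size F
      go (suc k) F size<k Rs rooted with any? (λ i → F i ≟ᵇ true)
      ... | no edgeless =
        ≤-trans (subst (_≤ length Rs) (length-tabulate id)
                   (unique-⊆-length (allFin⁺ n) (tabulate⁺ root-of)))
                (m≤m+n _ _)
        where
          root-of : ∀ v → v ∈ Rs
          root-of v with rooted v
          ... | r , r∈Rs , v⇝r = subst (_∈ Rs) (sym (walk-empty none v⇝r)) r∈Rs
            where
              none : ∀ i → F i ≡ false
              none i with F i in Fᵢ
              ... | true = ⊥-elim (edgeless (i , Fᵢ))
              ... | false = refl
      ... | yes (i , Fᵢ) =
        ≤-trans (go k F' (≤-trans shrink (s≤s⁻¹ size<k)) (new ∷ Rs) rooted')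
                (subst (_≤ length Rs + size F) (+-suc (length Rs) (size F')) (+-monoʳ-≤ (length Rs) shrink))
        where
          F' : EdgeSet m
          F' = del ends F i
          shrink : size F' < size F
          shrink = size-shrinks i (del-⊆ F i) (trans (cong (λ s → F i ∧ not s) (dec-true (i ≟ i) refl))
                                                       (∧-zeroʳ (F i))) Fᵢ
          old : Fin n
          old = proj₁ (rooted (e₁ i))
          old∈Rs : old ∈ Rs
          old∈Rs = proj₁ (proj₂ (rooted (e₁ i)))
          -- one end of i (kept) still reaches the old root; the other end is the new root
          kept-new : ∃[ a ] ∃[ b ] (Joins ends i a b × Walk F' a old)
          kept-new with [ inj₁ , id ]′ (del-splits {i = i} (walk-sym (proj₂ (proj₂ (rooted (e₁ i))))))
          ... | inj₁ old⇝e₁ = e₁ i , e₂ i , inj₁ (refl , refl) , walk-sym old⇝e₁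
          ... | inj₂ old⇝e₂ = e₂ i , e₁ i , inj₂ (refl , refl) , walk-sym old⇝e₂
          new : Fin n
          new = proj₁ (proj₂ kept-new)
          rooted' : Rooted F' (new ∷ Rs)
          rooted' v with rooted v | kept-new
          ... | r , r∈Rs , v⇝r | a , b , a-b , a⇝old with del-splits {i = i} v⇝r
          ...   | inj₁ v⇝r' = r , there r∈Rs , v⇝r'
          ...   | inj₂ touch with a-b | touch
          ...     | inj₁ (refl , refl) | inj₁ v⇝a = old , there old∈Rs , walk-trans v⇝a a⇝old
          ...     | inj₁ (refl , refl) | inj₂ v⇝b = b , here refl , v⇝b
          ...     | inj₂ (refl , refl) | inj₁ v⇝b = b , here refl , v⇝b
          ...     | inj₂ (refl , refl) | inj₂ v⇝a = old , there old∈Rs , walk-trans v⇝a a⇝old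

  -- A tree has no loops: without a loop it would be a connected graph on n vertices
  -- with fewer than n - 1 edges.
  Loopless : Set
  Loopless = ∀ i → e₁ i ≢ e₂ i

  tree-loopless : IsTree ends → Loopless
  tree-loopless (m+1≡n , connected) i loop =
    m+1+n≰m m (subst (_≤ m) (sym m+1≡n) (≤-trans vertices (subst (suc (size F') ≤_) (ΣF-one m) shrink)))
    where
      F' : EdgeSet m
      F' = del ends (λ _ → true) i
      vertices : n ≤ 1 + size F'
      vertices = vertices≤roots+edges F' (e₁ i ∷ [])
                   (λ v → e₁ i , here refl , loop-deletion loop (connected v (e₁ i)))
      shrink : size F' < size (λ _ → true)
      shrink = size-shrinks i (del-⊆ _ i) (cong not (dec-true (i ≟ i) refl)) refl

  -- number of ends of the edge i at v; deg v is the weight of incidence v over all edges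
  incidence : Fin n → Fin m → ℕ
  incidence v i = (if does (e₁ i ≟ v) then 1 else 0) + (if does (e₂ i ≟ v) then 1 else 0)

  incidence≤1 : ∀ {i} v → e₁ i ≢ e₂ i → incidence v i ≤ 1
  incidence≤1 {i} v e₁≢e₂ with e₁ i ≟ v | e₂ i ≟ v
  ... | yes e₁≡v | yes e₂≡v = ⊥-elim (e₁≢e₂ (trans e₁≡v (sym e₂≡v)))
  ... | yes _ | no _ = ≤-refl
  ... | no _ | yes _ = ≤-refl
  ... | no _ | no _ = z≤n

  incidence-end : ∀ {i} v → 0 < incidence v i → End i v
  incidence-end {i} v pos with e₁ i ≟ v | e₂ i ≟ v
  ... | yes e₁≡v | _ = inj₁ e₁≡v
  ... | no _ | yes e₂≡v = inj₂ e₂≡v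
  ... | no _ | no _ with pos
  ...   | ()

  -- Degree bound: in a loopless graph the edges at v that are deleted in one
  -- iteration lie in a common component, so there is at most one of them; hence
  -- the degree of v in F is at most the number of remaining iterations.
  degree≤depth : Loopless → ∀ {F d} → Run ends F d → ∀ v → weight F (incidence v) ≤ d
  degree≤depth _ (stop none) v = ≤-reflexive (weight-empty (incidence v) none)
  degree≤depth loopless {F} (iter _ (S , _ , one-per-component , _ , F'≡) run) v =
    ≤-trans (weight-drop≤1 (incidence v) F'≡ (λ i → incidence≤1 v (loopless i)) at-most-one)
            (s≤s (degree≤depth loopless run v))
    where
      v⇝ : ∀ {i} → F i ≡ true → 0 < incidence v i → Walk F v (e₁ i)
      v⇝ Fᵢ vᵢ = touches-end₁ Fᵢ (end-touches (incidence-end v vᵢ))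
      at-most-one : ∀ i j → F i ∧ S i ≡ true → F j ∧ S j ≡ true →
                    0 < incidence v i → 0 < incidence v j → i ≡ j
      at-most-one i j FSᵢ FSⱼ vᵢ vⱼ =
        one-per-component i j (∧-conicalʳ (F i) _ FSᵢ) (∧-conicalʳ (F j) _ FSⱼ)
          (walk-trans (walk-sym (v⇝ (∧-conicalˡ (F i) _ FSᵢ) vᵢ)) (v⇝ (∧-conicalˡ (F j) _ FSⱼ) vⱼ))

  -- Logarithmic bound: if d iterations run from F, then every component of F has at
  -- most 2^d vertices, since one iteration splits it into the vertices touching
  -- either end of its deleted edge.
  component-size : ∀ {F d} → Run ends F d → ∀ {r L} → Unique L → All (Walk F r) L → length L ≤ 2 ^ d
  component-size (stop none) uniq r⇝L = unique-constant uniq (mapAll (walk-empty none) r⇝L)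
  component-size (iter _ _ _) {L = []} _ _ = z≤n
  component-size {d = d} (iter _ _ _) {L = _ ∷ []} _ _ = m^n>0 2 d
  component-size {F} {suc d} (iter _ st@(_ , _ , _ , covered , _) run) {L = L@(_ ∷ _ ∷ _)}
                 uniq@((x≢y ∷ _) ∷ _) r⇝L@(r⇝x ∷ r⇝y ∷ _)
    with first-edge (walk-trans (walk-sym r⇝x) r⇝y) x≢y
  ... | i , Fᵢ , x⇝i with covered i Fᵢ
  ... | e , Sₑ , i⇝e =
    subst (λ k → length L ≤ 2 ^ d + k) (sym (+-identityʳ (2 ^ d)))
      (length-split half half uniq (mapAll touches r⇝L))
    where
      touches : ∀ {u} → Walk F _ u → Touches _ u e
      touches r⇝u = step-splits st e Sₑ (walk-trans (walk-sym r⇝u) (walk-trans r⇝x (walk-trans x⇝i i⇝e)))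
      half : ∀ {w K} → Unique K → All (λ u → Walk _ u w) K → length K ≤ 2 ^ d
      half uniqK K⇝w = component-size run uniqK (mapAll walk-sym K⇝w)

open Forest using (tree-loopless; depth≤size; degree≤depth; component-size)

lemma3p0 : ∀ (n m : ℕ) (ends : Fin m → Fin n × Fin n) → 2 ≤ n → IsTree ends →
           ∀ (d : ℕ) → IsDepth ends d →
           (Δ ends ⊔ ⌈log₂ n ⌉ ≤ d) × (d ≤ n ∸ 1)
lemma3p0 (suc n) m ends (s≤s _) tree@(m+1≡n , connected) d run = ⊔-lub Δ≤d log≤d , d≤n-1
  where
    -- the tree has n edges and n + 1 vertices
    edges : m ≡ n
    edges = suc-injective (trans (+-comm 1 m) m+1≡n)
    d≤n-1 : d ≤ n
    d≤n-1 = subst (d ≤_) (trans (ΣF-one m) edges) (depth≤size ends run)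
    Δ≤d : Δ ends ≤ d
    Δ≤d = foldr-preservesᵇ {P = _≤ d} ⊔-lub z≤n
            (tabulate⁺ (degree≤depth ends (tree-loopless ends tree) run))
    vertices≤2^d : suc n ≤ 2 ^ d
    vertices≤2^d = subst (_≤ 2 ^ d) (length-tabulate id)
                     (component-size ends run (allFin⁺ (suc n)) (tabulate⁺ (connected zero)))
    log≤d : ⌈log₂ suc n ⌉ ≤ d
    log≤d = subst (⌈log₂ suc n ⌉ ≤_) (⌈log₂2^n⌉≡n d) (⌈log₂⌉-mono-≤ vertices≤2^d)
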